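{- Let $x,y\in\Sigma^n$ and let $G_{x,y}$ be the grid graph defined in the context, with cost function $c$. Suppose vertex $(i,d)$ is potent, with $i<n$ and $(i,d)$ reachable from $(0,0)$. If diagonal $d$ has a mismatch at row $i+1$ (i.e., $x_{i+1}\neq y_{i+1+d}$), then $c(i+1,d)=c(i,d)+1$. Otherwise (it has a match, $x_{i+1}=y_{i+1+d}$), $c(i+1,d)=c(i,d)$ and $(i+1,d)$ is potent.
   Context: Grid graph $G_{x,y}$: vertex set $[0..n]\times[-n..n]$ (a vertex $(i,d)$ has row $i$ and diagonal $d$), with the following weighted edges whenever both endpoints are vertices: deletion edges $(i,d)\to(i+1,d-1)$ of weight $1$; insertion edges $(i,d)\to(i,d+1)$ of weight $1$; matching/substitution edges $(i,d)\to(i+1,d)$ (present when $1\le i+d+1\le n$) of weight $0$ if $x_{i+1}=y_{i+d+1}$ and $1$ otherwise. $c(i,d)$ is the minimum weight of a path from $(0,0)$ to $(i,d)$. Diagonal $d$ has a match at row $i$ if $x_i=y_{i+d}$ and a mismatch if $x_i\neq y_{i+d}$. A vertex $(i,d)$ with $h=c(i,d)$ is dominated by an in-neighbor $(i,d-1)$ or $(i-1,d+1)$ if that in-neighbor has cost $h-1$. Potent (defined recursively in lexicographic order of (row, diagonal)): vertex $(i,d)$ is potent if (a) whenever $(i,d)$ is dominated by $(i,d-1)$, vertex $(i,d-1)$ is potent and diagonal $d-1$ has a mismatch at row $i+1$; and (b) whenever $(i,d)$ is dominated by $(i-1,d+1)$, vertex $(i-1,d+1)$ is potent and diagonal $d+1$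 has a mismatch at row $i$. A non-dominated vertex is potent. Nonexistent objects are ignored. -}

module Defs where

open import Data.Nat using (ℕ; zero; suc; _≤_; _<_)
open import Data.Integer using (ℤ; +_; -_; _+_; _-_) renaming (_≤_ to _≤ℤ_)
open import Data.Fin using (Fin; toℕ)
open import Data.Product using (Σ; ∃; _×_)
open import Relation.Binary.PropositionalEquality using (_≡_)
open import Relation.Nullary using (¬_)

-- Strings x, y ∈ Σⁿ are functions Fin n → Σ; the paper's 1-based character
-- x_r (1 ≤ r ≤ n) is  x a  with  toℕ a + 1 = r.
-- Vertices (i , d) : i is a row (ℕ), d a diagonal (ℤ).
module Grid {A : Set} {n : ℕ} (x y : Fin n → A) where

  Vertex : ℕ → ℤ → Set
  Vertex i d = (i ≤ n) × ((- (+ n)) ≤ℤ d) × (d ≤ℤ + n)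

  Match : ℕ → ℤ → Set
  Match r d = Σ (Fin n) λ a → Σ (Fin n) λ b →
    (suc (toℕ a) ≡ r) × (+ suc (toℕ b) ≡ (+ r) + d) × (x a ≡ y b)

  Mismatch : ℕ → ℤ → Set
  Mismatch r d = Σ (Fin n) λ a → Σ (Fin n) λ b →
    (suc (toℕ a) ≡ r) × (+ suc (toℕ b) ≡ (+ r) + d) × ¬ (x a ≡ y b)

  data Edge : ℕ → ℤ → ℕ → ℤ → ℕ → Set where
    deletion  : ∀ {i d} → Vertex i d → Vertex (suc i) (d - + 1) →
                Edge i d (suc i) (d - + 1) 1
    insertion : ∀ {i d} → Vertex i d → Vertex i (d + + 1) →
                Edge i d i (d + + 1) 1
    matching  : ∀ {i d} → Vertex i d → Vertex (suc i) d → Match (suc i) d →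
                Edge i d (suc i) d 0
    substitution : ∀ {i d} → Vertex i d → Vertex (suc i) d → Mismatch (suc i) d →
                Edge i d (suc i) d 1

  data Path : ℕ → ℤ → ℕ → ℤ → ℕ → Set where
    [] : ∀ {i d} → Path i d i d 0
    _∷_ : ∀ {i d j e k f w v} → Edge i d j e w → Path j e k f v →
          Path i d k f (w Data.Nat.+ v)

  Reachable : ℕ → ℤ → Set
  Reachable i d = ∃ λ w → Path 0 (+ 0) i d w

  Cost : ℕ → ℤ → ℕ → Set
  Cost i d h = Path 0 (+ 0) i d h × (∀ w → Path 0 (+ 0) i d w → h ≤ w)

  -- Potent, as the inductive (least) predicate of the well-founded recursive
  -- definition.  (i , d) with c(i,d) = suc h is dominated by (i , d-1) when
  -- c(i,d-1) = h, and by (i-1 , d+1) when i = suc i' and c(i',d+1) = h.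
  -- "has a mismatch" in the potency conditions is read as "has no match"
  -- (a nonexistent character comparison is ignored).
  data Potent : ℕ → ℤ → Set where
    potent : ∀ {i d} →
      (∀ {h} → Cost i d (suc h) → Cost i (d - + 1) h →
         Potent i (d - + 1) × ¬ Match (suc i) (d - + 1)) →
      (∀ {h i'} → i ≡ suc i' → Cost i d (suc h) → Cost i' (d + + 1) h →
         Potent i' (d + + 1) × ¬ Match i (d + + 1)) →
      Potent i d

-- The column i + d never decreases along an edge, so no path from (0 , 0) ends at
-- (0 , -1); and a path to (i , d + 1) or to (i + 1 , d - 1) can be rerouted to one
-- to (i , d) that is at most one unit heavier.  Let (i , d) be potent with cost h.
-- Its insertion and deletion targets (i , d + 1) and (i + 1 , d - 1) cost at least
-- h, by induction on a path to the target: if the path were cheaper, rerouting it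
-- would show that (i , d) is dominated; the dominator is potent, so induction applies
-- to the path's prefix, and its diagonal has no match, so the last edge is not a free
-- match.  These two targets are the other in-neighbours of (i + 1 , d), which
-- therefore costs at least h, and at least h + 1 on a mismatch.  On a match the
-- matching edge attains h, and (i + 1 , d) is not dominated because both of those
-- in-neighbours cost at least h.
module Submission where

open import Defs
open import Data.Nat using (ℕ; suc; _<_)
open import Data.Integer using (ℤ)
open import Data.Fin using (Fin)
open import Data.Product using (_×_)

open import Data.Nat using (_+_; _≤_; z≤n; s≤s)
open import Data.Nat.Properties
  using ( ≤-refl; ≤-trans; <⇒≤; <⇒≱; ≤-pred; m≤n⇒m≤1+n; m≤n⇒m<n∨m≡n; suc-injective; +-identityʳ
        ; +-commutativeSemigroup)
open import Algebra.Properties.CommutativeSemigroup +-commutativeSemigroup using (x∙yz≈y∙xz; x∙yz≈yx∙z)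
open import Data.Integer using (+_; -_; +≤+) renaming (_+_ to _+ℤ_; _-_ to _-ℤ_; _≤_ to _≤ℤ_)
import Data.Integer.Properties as ℤ
open import Algebra.Properties.AbelianGroup ℤ.+-0-abelianGroup using (∙-cancelʳ)
open import Data.Integer.Tactic.RingSolver using (solve-∀)
open import Data.Fin.Properties using (toℕ-injective)
open import Data.Product using (∃; _,_; proj₁; proj₂; map₁)
open import Data.Sum using (_⊎_; inj₁; inj₂; [_,_]′)
open import Data.Empty using (⊥-elim)
open import Function using (id)
open import Relation.Binary.PropositionalEquality
open import Relation.Nullary using (¬_)

i+1-1≡i : ∀ i → i +ℤ + 1 -ℤ + 1 ≡ i
i+1-1≡i = solve-∀

i-1+1≡i : ∀ i → i -ℤ + 1 +ℤ + 1 ≡ i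
i-1+1≡i = solve-∀

i+1≡j⇒i≡j-1 : ∀ {i j} → i +ℤ + 1 ≡ j → i ≡ j -ℤ + 1
i+1≡j⇒i≡j-1 {i} i+1≡j = trans (sym (i+1-1≡i i)) (cong (_-ℤ + 1) i+1≡j)

i-1≡j⇒i≡j+1 : ∀ {i j} → i -ℤ + 1 ≡ j → i ≡ j +ℤ + 1
i-1≡j⇒i≡j+1 {i} i-1≡j = trans (sym (i-1+1≡i i)) (cong (_+ℤ + 1) i-1≡j)

-- Stated with + 1 +ℤ i because + suc i reduces to + 1 +ℤ + i.
[1+i]+j≡i+[j+1] : ∀ i j → (+ 1 +ℤ i) +ℤ j ≡ i +ℤ (j +ℤ + 1)
[1+i]+j≡i+[j+1] = solve-∀

[1+i]+[j-1]≡i+j : ∀ i j → (+ 1 +ℤ i) +ℤ (j -ℤ + 1) ≡ i +ℤ j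
[1+i]+[j-1]≡i+j = solve-∀

[1+i]+j≡[i+j]+1 : ∀ i j → (+ 1 +ℤ i) +ℤ j ≡ (i +ℤ j) +ℤ + 1
[1+i]+j≡[i+j]+1 = solve-∀

i+[j+1]≡[i+j]+1 : ∀ i j → i +ℤ (j +ℤ + 1) ≡ (i +ℤ j) +ℤ + 1
i+[j+1]≡[i+j]+1 = solve-∀

module EditGraph {A : Set} {n : ℕ} (x y : Fin n → A) where
  open Grid x y

  column : ℕ → ℤ → ℤ
  column i d = + i +ℤ d

  column-suc : ∀ i d → column (suc i) d ≡ column i (d +ℤ + 1)
  column-suc i = [1+i]+j≡i+[j+1] (+ i)

  column[0,d]≥0⇒d+1≢0 : ∀ d → + 0 ≤ℤ column 0 d → + 0 ≢ d +ℤ + 1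
  column[0,d]≥0⇒d+1≢0 d 0≤d 0≡d+1
    with () ← subst (λ e → + 0 ≤ℤ column 0 e) (i+1≡j⇒i≡j-1 {d} (sym 0≡d+1)) 0≤d

  vertex-at-next-row : ∀ {i d} → suc i ≤ n → Vertex i d → Vertex (suc i) d
  vertex-at-next-row i<n (_ , bounds) = i<n , bounds

  vertex-at-smaller-diagonal : ∀ {i d e} → Vertex i d → - (+ n) ≤ℤ e → e ≤ℤ d → Vertex i e
  vertex-at-smaller-diagonal (i≤n , _ , d≤n) -n≤e e≤d = i≤n , -n≤e , ℤ.≤-trans e≤d d≤n

  deletion-source-vertex : ∀ {i d} → Vertex (suc i) d → d +ℤ + 1 ≤ℤ + n → Vertex i (d +ℤ + 1)
  deletion-source-vertex {d = d} (1+i≤n , -n≤d , _) d+1≤n =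
    <⇒≤ 1+i≤n , ℤ.≤-trans -n≤d (ℤ.i≤i+j d (+ 1)) , d+1≤n

  edge-target-vertex : ∀ {i d j e u} → Edge i d j e u → Vertex j e
  edge-target-vertex (deletion _ v)       = v
  edge-target-vertex (insertion _ v)      = v
  edge-target-vertex (matching _ v _)     = v
  edge-target-vertex (substitution _ v _) = v

  edge-column-≤ : ∀ {i d j e u} → Edge i d j e u → column i d ≤ℤ column j e
  edge-column-≤ {i} {d} (deletion _ _) = ℤ.≤-reflexive (sym ([1+i]+[j-1]≡i+j (+ i) d))
  edge-column-≤ {i} {d} (insertion _ _) =
    subst (column i d ≤ℤ_) (sym (i+[j+1]≡[i+j]+1 (+ i) d)) (ℤ.i≤i+j (column i d) (+ 1))
  edge-column-≤ {i} {d} (matching _ _ _) =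
    subst (column i d ≤ℤ_) (sym ([1+i]+j≡[i+j]+1 (+ i) d)) (ℤ.i≤i+j (column i d) (+ 1))
  edge-column-≤ {i} {d} (substitution _ _ _) =
    subst (column i d ≤ℤ_) (sym ([1+i]+j≡[i+j]+1 (+ i) d)) (ℤ.i≤i+j (column i d) (+ 1))

  match⇒¬mismatch : ∀ {r d} → Match r d → ¬ Mismatch r d
  match⇒¬mismatch (a , b , a≡r , b≡r+d , xa≡yb) (a′ , b′ , a′≡r , b′≡r+d , xa′≢yb′) =
    xa′≢yb′ (subst₂ (λ u v → x u ≡ y v) (toℕ-injective (suc-injective (trans a≡r (sym a′≡r))))
      (toℕ-injective (suc-injective (ℤ.+-injective (trans b≡r+d (sym b′≡r+d))))) xa≡yb)

  -- Paths from (0 , 0) built from their last edge, so that induction can inspect it.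
  -- The edge weight comes first, so edges of weight 0 and 1 give weights w and suc w.
  data PathTo : ℕ → ℤ → ℕ → Set where
    []   : PathTo 0 (+ 0) 0
    _∷ʳ_ : ∀ {i d j e v u} → PathTo i d v → Edge i d j e u → PathTo j e (u + v)

  retarget : ∀ {i d e w} → d ≡ e → PathTo i d w → PathTo i e w
  retarget d≡e = subst (λ f → PathTo _ f _) d≡e

  endpoint-vertex : ∀ {i d w} → PathTo i d w → Vertex i d
  endpoint-vertex []        = z≤n , ℤ.neg-≤-pos , +≤+ z≤n
  endpoint-vertex (_ ∷ʳ ed) = edge-target-vertex ed

  endpoint-column≥0 : ∀ {i d w} → PathTo i d w → + 0 ≤ℤ column i d
  endpoint-column≥0 []        = +≤+ z≤n
  endpoint-column≥0 (p ∷ʳ ed) = ℤ.≤-trans (endpoint-column≥0 p) (edge-column-≤ ed)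

  extend-by-deletion : ∀ {i d e w} → PathTo i e w → e -ℤ + 1 ≡ d → Vertex (suc i) d →
                       PathTo (suc i) d (suc w)
  extend-by-deletion p refl v = p ∷ʳ deletion (endpoint-vertex p) v

  extend-by-insertion : ∀ {i d e w} → PathTo i e w → e +ℤ + 1 ≡ d → Vertex i d →
                        PathTo i d (suc w)
  extend-by-insertion p refl v = p ∷ʳ insertion (endpoint-vertex p) v

  append-edge : ∀ {i d j e k f v u} → Path i d j e v → Edge j e k f u → Path i d k f (u + v)
  append-edge [] ed = ed ∷ []
  append-edge (_∷_ {w = w} {v = v} ed′ p) ed =
    subst (Path _ _ _ _) (x∙yz≈y∙xz w _ v) (ed′ ∷ append-edge p ed)

  toPath : ∀ {i d w} → PathTo i d w → Path 0 (+ 0) i d w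
  toPath []        = []
  toPath (p ∷ʳ ed) = append-edge (toPath p) ed

  append-path : ∀ {i d j e v w} → PathTo i d v → Path i d j e w → PathTo j e (w + v)
  append-path p [] = p
  append-path {v = v} p (_∷_ {w = u} {v = w} ed q) =
    subst (PathTo _ _) (x∙yz≈yx∙z w u v) (append-path (p ∷ʳ ed) q)

  fromPath : ∀ {i d w} → Path 0 (+ 0) i d w → PathTo i d w
  fromPath {w = w} q = subst (PathTo _ _) (+-identityʳ w) (append-path [] q)

  LowerBound : ℕ → ℤ → ℕ → Set
  LowerBound i d h = ∀ {w} → PathTo i d w → h ≤ w

  CostTo : ℕ → ℤ → ℕ → Set
  CostTo i d h = PathTo i d h × LowerBound i d h

  toCost : ∀ {i d h} → CostTo i d h → Cost i d h
  toCost (p , h≤) = toPath p , λ _ q → h≤ (fromPath q)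

  fromCost : ∀ {i d h} → Cost i d h → CostTo i d h
  fromCost (p , h≤) = fromPath p , λ q → h≤ _ (toPath q)

  undo-insertion : ∀ {i d f w} → PathTo i f w → f ≡ d +ℤ + 1 → Vertex i d → + 0 ≤ℤ column i d →
                   ∃ λ s → PathTo i d s × s ≤ suc w
  undo-insertion {d = d} [] 0≡d+1 _ 0≤col = ⊥-elim (column[0,d]≥0⇒d+1≢0 d 0≤col 0≡d+1)
  undo-insertion (_∷ʳ_ {v = v} p (insertion _ _)) e+1≡d+1 _ _ =
    v , retarget (∙-cancelʳ (+ 1) _ _ e+1≡d+1) p , m≤n⇒m≤1+n (m≤n⇒m≤1+n ≤-refl)
  undo-insertion {suc i} {d} (p ∷ʳ deletion _ (_ , _ , e-1≤n)) e-1≡d+1 v 0≤col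
    with undo-insertion p (i-1≡j⇒i≡j+1 e-1≡d+1)
           (deletion-source-vertex v (subst (_≤ℤ + n) e-1≡d+1 e-1≤n))
           (subst (+ 0 ≤ℤ_) (column-suc i d) 0≤col)
  ... | s , S , s≤1+r = suc s , extend-by-deletion S (i+1-1≡i d) v , s≤s s≤1+r
  undo-insertion {d = d} (_∷ʳ_ {v = q} p (matching _ _ _)) refl v _ =
    suc q , extend-by-deletion p (i+1-1≡i d) v , ≤-refl
  undo-insertion {d = d} (_∷ʳ_ {v = q} p (substitution _ _ _)) refl v _ =
    suc q , extend-by-deletion p (i+1-1≡i d) v , m≤n⇒m≤1+n ≤-refl

  undo-deletion : ∀ {i f w} → PathTo (suc i) f w → Vertex i (f +ℤ + 1) →
                  ∃ λ s → PathTo i (f +ℤ + 1) s × s ≤ suc w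
  undo-deletion (_∷ʳ_ {v = v} p (deletion _ _)) _ =
    v , retarget (sym (i-1+1≡i _)) p , m≤n⇒m≤1+n (m≤n⇒m≤1+n ≤-refl)
  undo-deletion (p ∷ʳ insertion _ (_ , -n≤e+1 , _)) v
    with undo-deletion p (vertex-at-smaller-diagonal v -n≤e+1 (ℤ.i≤i+j _ (+ 1)))
  ... | s , S , s≤1+r = suc s , extend-by-insertion S refl v , s≤s s≤1+r
  undo-deletion (_∷ʳ_ {v = q} p (matching _ _ _)) v =
    suc q , extend-by-insertion p refl v , ≤-refl
  undo-deletion (_∷ʳ_ {v = q} p (substitution _ _ _)) v =
    suc q , extend-by-insertion p refl v , m≤n⇒m≤1+n ≤-refl

  ≤-or-dominated : ∀ {i d h j e v} → CostTo i d h → PathTo j e v →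
                   (∀ {w} → PathTo j e w → PathTo i d (suc w)) →
                   h ≤ v ⊎ (h ≡ suc v × CostTo j e v)
  ≤-or-dominated (_ , h≤) q reroute with m≤n⇒m<n∨m≡n (h≤ (reroute q))
  ... | inj₁ h<1+v = inj₁ (≤-pred h<1+v)
  ... | inj₂ refl  = inj₂ (refl , q , λ q′ → ≤-pred (h≤ (reroute q′)))

  insertion-dominator-potent : ∀ {i d h} → Potent i d → CostTo i d (suc h) →
                               CostTo i (d -ℤ + 1) h →
                               Potent i (d -ℤ + 1) × ¬ Match (suc i) (d -ℤ + 1)
  insertion-dominator-potent (potent dom _) C C′ = dom (toCost C) (toCost C′)

  deletion-dominator-potent : ∀ {i d h} → Potent (suc i) d → CostTo (suc i) d (suc h) →
                              CostTo i (d +ℤ + 1) h →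
                              Potent i (d +ℤ + 1) × ¬ Match (suc i) (d +ℤ + 1)
  deletion-dominator-potent (potent _ dom) C C′ = dom refl (toCost C) (toCost C′)

  potent⇒insertion-lowerBound : ∀ {i d h} → Potent i d → CostTo i d h →
                                LowerBound i (d +ℤ + 1) h
  potent⇒insertion-lowerBound pot C p = go pot C p refl
    where
    go : ∀ {i d h f w} → Potent i d → CostTo i d h → PathTo i f w → f ≡ d +ℤ + 1 → h ≤ w
    go {d = d} _ (cp , _) [] 0≡d+1 = ⊥-elim (column[0,d]≥0⇒d+1≢0 d (endpoint-column≥0 cp) 0≡d+1)
    go _ (_ , h≤) (p ∷ʳ insertion _ _) e+1≡d+1 =
      m≤n⇒m≤1+n (h≤ (retarget (∙-cancelʳ (+ 1) _ _ e+1≡d+1) p))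
    go {suc i} {d} pot C@(cp , _) (p ∷ʳ deletion _ (_ , _ , e-1≤n)) e-1≡d+1
      with undo-insertion p (i-1≡j⇒i≡j+1 e-1≡d+1)
             (deletion-source-vertex (endpoint-vertex cp) (subst (_≤ℤ + n) e-1≡d+1 e-1≤n))
             (subst (+ 0 ≤ℤ_) (column-suc i d) (endpoint-column≥0 cp))
    ... | s , S , s≤1+r
      with ≤-or-dominated C S (λ q → extend-by-deletion q (i+1-1≡i d) (endpoint-vertex cp))
    ... | inj₁ h≤s = ≤-trans h≤s s≤1+r
    ... | inj₂ (refl , C′) =
      s≤s (go (proj₁ (deletion-dominator-potent pot C C′)) C′ p (i-1≡j⇒i≡j+1 e-1≡d+1))
    go {suc i} {d} pot C@(cp , _) (p ∷ʳ matching _ _ m) refl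
      with ≤-or-dominated C p (λ q → extend-by-deletion q (i+1-1≡i d) (endpoint-vertex cp))
    ... | inj₁ h≤q = h≤q
    ... | inj₂ (refl , C′) = ⊥-elim (proj₂ (deletion-dominator-potent pot C C′) m)
    go {d = d} _ (cp , h≤) (p ∷ʳ substitution _ _ _) refl =
      h≤ (extend-by-deletion p (i+1-1≡i d) (endpoint-vertex cp))

  potent⇒deletion-lowerBound : ∀ {i d h} → Potent i d → CostTo i d h →
                               LowerBound (suc i) (d -ℤ + 1) h
  potent⇒deletion-lowerBound pot C p = go pot C p refl
    where
    go : ∀ {i d h f w} → Potent i d → CostTo i d h → PathTo (suc i) f w → f ≡ d -ℤ + 1 → h ≤ w
    go _ (_ , h≤) (p ∷ʳ deletion _ _) e-1≡d-1 =
      m≤n⇒m≤1+n (h≤ (retarget (∙-cancelʳ (- + 1) _ _ e-1≡d-1) p))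
    go {i} {d} pot C@(cp , _) (p ∷ʳ insertion _ (_ , -n≤e+1 , _)) e+1≡d-1
      with undo-deletion p
             (vertex-at-smaller-diagonal (endpoint-vertex cp) -n≤e+1
               (ℤ.≤-trans (ℤ.≤-reflexive e+1≡d-1) (ℤ.i-j≤i d (+ 1))))
    ... | s , S , s≤1+r
      with ≤-or-dominated C (retarget e+1≡d-1 S)
             (λ q → extend-by-insertion q (i-1+1≡i d) (endpoint-vertex cp))
    ... | inj₁ h≤s = ≤-trans h≤s s≤1+r
    ... | inj₂ (refl , C′) =
      s≤s (go (proj₁ (insertion-dominator-potent pot C C′)) C′ p (i+1≡j⇒i≡j-1 e+1≡d-1))
    go {i} {d} pot C@(cp , _) (p ∷ʳ matching _ _ m) refl
      with ≤-or-dominated C p (λ q → extend-by-insertion q (i-1+1≡i d) (endpoint-vertex cp))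
    ... | inj₁ h≤q = h≤q
    ... | inj₂ (refl , C′) = ⊥-elim (proj₂ (insertion-dominator-potent pot C C′) m)
    go {d = d} _ (cp , h≤) (p ∷ʳ substitution _ _ _) refl =
      h≤ (extend-by-insertion p (i-1+1≡i d) (endpoint-vertex cp))

  potent⇒diagonal-lowerBound : ∀ {i d h w} → Potent i d → CostTo i d h → PathTo (suc i) d w →
                               suc h ≤ w ⊎ (Match (suc i) d × h ≤ w)
  potent⇒diagonal-lowerBound pot C (p ∷ʳ deletion _ _) =
    inj₁ (s≤s (potent⇒insertion-lowerBound pot C (retarget (sym (i-1+1≡i _)) p)))
  potent⇒diagonal-lowerBound pot C (p ∷ʳ insertion _ _) =
    inj₁ (s≤s (potent⇒deletion-lowerBound pot C (retarget (sym (i+1-1≡i _)) p)))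
  potent⇒diagonal-lowerBound _ (_ , h≤) (p ∷ʳ matching _ _ m) = inj₂ (m , h≤ p)
  potent⇒diagonal-lowerBound _ (_ , h≤) (p ∷ʳ substitution _ _ _) = inj₁ (s≤s (h≤ p))

  undominated⇒potent : ∀ {i d h} → CostTo i d h → LowerBound i (d -ℤ + 1) h →
                       (∀ {i′} → i ≡ suc i′ → LowerBound i′ (d +ℤ + 1) h) → Potent i d
  undominated⇒potent {h = h} (p , _) h≤ins-source h≤del-source = potent
    (λ (_ , min) (q , _) →
       ⊥-elim (<⇒≱ (min h (toPath p)) (h≤ins-source (fromPath q))))
    (λ i≡1+i′ (_ , min) (q , _) →
       ⊥-elim (<⇒≱ (min h (toPath p)) (h≤del-source i≡1+i′ (fromPath q))))

  potent-mismatch-step : ∀ {i d h} → Potent i d → i < n → Mismatch (suc i) d →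
                         CostTo i d h → CostTo (suc i) d (suc h)
  potent-mismatch-step {i} {d} pot i<n mm C@(p , _) =
    p ∷ʳ substitution (endpoint-vertex p) (vertex-at-next-row i<n (endpoint-vertex p)) mm ,
    λ q → [ id , (λ (m , _) → ⊥-elim (match⇒¬mismatch {suc i} {d} m mm)) ]′
            (potent⇒diagonal-lowerBound pot C q)

  potent-match-step : ∀ {i d h} → Potent i d → i < n → Match (suc i) d →
                      CostTo i d h → CostTo (suc i) d h × Potent (suc i) d
  potent-match-step {i} {d} {h} pot i<n m C@(p , _) =
    C′ , undominated⇒potent C′ (potent⇒deletion-lowerBound pot C)
           (λ { refl → potent⇒insertion-lowerBound pot C })
    where
    C′ : CostTo (suc i) d h
    C′ = p ∷ʳ matching (endpoint-vertex p) (vertex-at-next-row i<n (endpoint-vertex p)) m ,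
         λ q → [ <⇒≤ , proj₂ ]′ (potent⇒diagonal-lowerBound pot C q)

lemma3p4 : {A : Set} (n : ℕ) (x y : Fin n → A) (i : ℕ) (d : ℤ) →
    Grid.Potent x y i d → i < n → Grid.Reachable x y i d →
    ((Grid.Mismatch x y (suc i) d →
        ∀ h → Grid.Cost x y i d h → Grid.Cost x y (suc i) d (suc h))
    × (Grid.Match x y (suc i) d →
        ∀ h → Grid.Cost x y i d h → Grid.Cost x y (suc i) d h × Grid.Potent x y (suc i) d))
lemma3p4 n x y i d pot i<n _ =
    (λ mm _ C → toCost (potent-mismatch-step pot i<n mm (fromCost C)))
  , (λ m _ C → map₁ toCost (potent-match-step pot i<n m (fromCost C)))
  where open EditGraph x y
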